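{- Let $P=(p_1,\dots,p_u)$ be a partition of $n$, and let $O$ be a symmetric rational outline rectangle associated to $(P,P,P)$. For $i,j\in[u]$ put $y(i,j)=\sum_{k\in[u]}\{O_k(i,j)\}$, where $\{x\}=x-\lfloor x\rfloor$ denotes the fractional part. Suppose $B$ is a $u\times u$ array of multisets with elements from $[u]$ such that, for all $i,j\in[u]$: cell $(i,j)$ of $B$ contains exactly $y(i,j)$ entries (counted with multiplicity); symbol $j$ occurs exactly $y(i,j)$ times in row $i$ of $B$; and symbol $j$ occurs exactly $y(i,j)$ times in column $i$ of $B$. Then there exists an outline rectangle associated to $(P,P,P)$.
   Context: For a positive integer $m$, $[m]=\{1,\dots,m\}$. A partition of $n$ is a non-increasing sequence of positive integers summing to $n$. Given partitions $P=(p_1,\dots,p_u)$, $Q=(q_1,\dots,q_v)$, $R=(r_1,\dots,r_t)$ of $n$, an outline rectangle associated to $(P,Q,R)$ is a $u\times v$ array $O$ of multisets with elements from $[t]$ such that: cell $(i,j)$ contains exactly $p_iq_j$ entries counted with multiplicity; symbol $l$ occurs $p_ir_l$ times in row $i$; and symbol $l$ occurs $q_jr_l$ times in column $j$. A rational outline rectangle associated to $(P,Q,R)$ is a family of non-negative rational numbers $O_k(i,j)$ ($i\in[u]$, $j\in[v]$, $k\in[t]$) such that $\sum_{k}O_k(i,j)=p_iq_j$ for all $i,j$; $\sum_{j}O_k(i,j)=p_ir_k$ for all $i,k$; and $\sum_{i}O_k(i,j)=q_jr_k$ for all $j,k$. It is symmetric if $P=Q=R$ and $O_k(i,j)=O_c(a,b)$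 for every permutation $(a,b,c)$ of $(i,j,k)$. -}

module Defs where

open import Data.Nat using (ℕ; zero; suc; _≥_; _≤_) renaming (_+_ to _+ℕ_; _*_ to _*ℕ_)
open import Data.Fin using (Fin; zero; suc)
open import Data.Integer using (+_)
open import Data.Rational using (ℚ; 0ℚ; floor; _/_; _-_) renaming (_+_ to _+ℚ_; _*_ to _*ℚ_; _≤_ to _≤ℚ_)
open import Data.Product using (_×_)
open import Relation.Binary.PropositionalEquality using (_≡_)

sumℕ : (m : ℕ) → (Fin m → ℕ) → ℕ
sumℕ zero    f = 0
sumℕ (suc m) f = f zero +ℕ sumℕ m (λ i → f (suc i))

sumℚ : (m : ℕ) → (Fin m → ℚ) → ℚ
sumℚ zero    f = 0ℚ
sumℚ (suc m) f = f zero +ℚ sumℚ m (λ i → f (suc i))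

ℕ→ℚ : ℕ → ℚ
ℕ→ℚ k = (+ k) / 1

frac : ℚ → ℚ
frac x = x - ((floor x) / 1)

IsPartition : (n u : ℕ) → (Fin u → ℕ) → Set
IsPartition n u p =
  (∀ i → p i ≥ 1) ×
  (∀ (i j : Fin u) → Data.Fin._≤_ i j → p j ≤ p i) ×
  (sumℕ u p ≡ n)

-- Rational outline rectangle for (P,Q,R): O k i j = O_k(i,j)
IsRationalOutline : (u v t : ℕ) → (Fin u → ℕ) → (Fin v → ℕ) → (Fin t → ℕ)
                  → (Fin t → Fin u → Fin v → ℚ) → Set
IsRationalOutline u v t p q r O =
  (∀ k i j → 0ℚ ≤ℚ O k i j) ×
  (∀ i j → sumℚ t (λ k → O k i j) ≡ ℕ→ℚ (p i *ℕ q j)) ×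
  (∀ i k → sumℚ v (λ j → O k i j) ≡ ℕ→ℚ (p i *ℕ r k)) ×
  (∀ j k → sumℚ u (λ i → O k i j) ≡ ℕ→ℚ (q j *ℕ r k))

-- symmetric: O_k(i,j) = O_c(a,b) for every permutation (a,b,c) of (i,j,k)
-- (generated by the two transpositions below; all six listed explicitly)
IsSymmetric : (u : ℕ) → (Fin u → Fin u → Fin u → ℚ) → Set
IsSymmetric u O = ∀ i j k →
  (O k i j ≡ O k j i) × (O k i j ≡ O j i k) × (O k i j ≡ O i k j) ×
  (O k i j ≡ O i j k) × (O k i j ≡ O j k i)

-- A u×v array of multisets over [t] is represented by multiplicities:
-- A i j l = number of occurrences of symbol l in cell (i,j).
-- Outline rectangle associated to (P,Q,R).
IsOutline : (u v t : ℕ) → (Fin u → ℕ) → (Fin v → ℕ) → (Fin t → ℕ)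
          → (Fin u → Fin v → Fin t → ℕ) → Set
IsOutline u v t p q r A =
  (∀ i j → sumℕ t (λ l → A i j l) ≡ p i *ℕ q j) ×
  (∀ i l → sumℕ v (λ j → A i j l) ≡ p i *ℕ r l) ×
  (∀ j l → sumℕ u (λ i → A i j l) ≡ q j *ℕ r l)

{-# OPTIONS --safe #-}
module Submission where

-- Put A(i,j,l) = B(i,j,l) + ⌊O_l(i,j)⌋.  Along every line of the array the
-- floors account for Σ O minus Σ {O}, and B supplies exactly Σ {O}, so every
-- line sum of A equals the corresponding (integral) line sum of O.  Symmetry
-- of O is only needed to read the row and column conditions on B as
-- conditions on the fractional parts of O along rows and columns.

open import Defs
open import Data.Nat using (ℕ; zero; suc; z≤n) renaming (_+_ to _+ℕ_)
open import Data.Fin using (Fin)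
open import Data.Integer using (+_; -[1+_]; ∣_∣; +≤+)
import Data.Integer as ℤ
import Data.Integer.Properties as ℤ
open import Data.Integer.DivMod using (0≤n⇒0≤n/d)
import Data.Nat.Coprimality as Coprimality
open import Data.Rational using (ℚ; mkℚ; ↥_; 0ℚ; floor; _/_; *≤*) renaming (_+_ to _+ℚ_; _≤_ to _≤ℚ_)
open import Data.Rational.Properties
  using (normalize-coprime; +-0-abelianGroup; +-0-commutativeMonoid)
open import Algebra.Bundles using (AbelianGroup; CommutativeMonoid)
open import Algebra.Properties.Group (AbelianGroup.group +-0-abelianGroup)
  using (//-rightDividesˡ)
open import Algebra.Properties.CommutativeSemigroup
  (CommutativeMonoid.commutativeSemigroup +-0-commutativeMonoid) using (interchange)
open import Data.Product using (Σ; _,_)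
open import Relation.Binary.PropositionalEquality
  using (_≡_; refl; sym; trans; cong; cong₂)
open Relation.Binary.PropositionalEquality.≡-Reasoning

ℕ→ℚ≡mkℚ : ∀ a → ℕ→ℚ a ≡ mkℚ (+ a) 0 (Coprimality.sym (Coprimality.1-coprimeTo a))
ℕ→ℚ≡mkℚ a = normalize-coprime (Coprimality.sym (Coprimality.1-coprimeTo a))

ℕ→ℚ-injective : ∀ {a b} → ℕ→ℚ a ≡ ℕ→ℚ b → a ≡ b
ℕ→ℚ-injective {a} {b} eq =
  ℤ.+-injective (cong ↥_ (trans (sym (ℕ→ℚ≡mkℚ a)) (trans eq (ℕ→ℚ≡mkℚ b))))

ℕ→ℚ-homo-+ : ∀ a b → ℕ→ℚ (a +ℕ b) ≡ ℕ→ℚ a +ℚ ℕ→ℚ b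
ℕ→ℚ-homo-+ a b = begin
  (+ (a +ℕ b)) / 1
    ≡⟨ cong (_/ 1) (ℤ.pos-+ a b) ⟩
  (+ a ℤ.+ + b) / 1
    ≡⟨ cong (_/ 1) (sym (cong₂ ℤ._+_ (ℤ.*-identityʳ (+ a)) (ℤ.*-identityʳ (+ b)))) ⟩
  (+ a ℤ.* + 1 ℤ.+ + b ℤ.* + 1) / 1
    ≡⟨ sym (cong₂ _+ℚ_ (ℕ→ℚ≡mkℚ a) (ℕ→ℚ≡mkℚ b)) ⟩
  ℕ→ℚ a +ℚ ℕ→ℚ b
    ∎

sumℚ-cong : ∀ m {f g : Fin m → ℚ} → (∀ i → f i ≡ g i) → sumℚ m f ≡ sumℚ m g
sumℚ-cong zero    eq = refl
sumℚ-cong (suc m) eq = cong₂ _+ℚ_ (eq Fin.zero) (sumℚ-cong m (λ i → eq (Fin.suc i)))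

sumℚ-distrib-+ : ∀ m (f g : Fin m → ℚ) →
                 sumℚ m (λ i → f i +ℚ g i) ≡ sumℚ m f +ℚ sumℚ m g
sumℚ-distrib-+ zero    f g = refl
sumℚ-distrib-+ (suc m) f g =
  trans (cong (f Fin.zero +ℚ g Fin.zero +ℚ_) (sumℚ-distrib-+ m (λ i → f (Fin.suc i)) (λ i → g (Fin.suc i))))
        (interchange (f Fin.zero) (g Fin.zero) _ _)

ℕ→ℚ-homo-sum : ∀ m (f : Fin m → ℕ) → ℕ→ℚ (sumℕ m f) ≡ sumℚ m (λ i → ℕ→ℚ (f i))
ℕ→ℚ-homo-sum zero    f = refl
ℕ→ℚ-homo-sum (suc m) f =
  trans (ℕ→ℚ-homo-+ (f Fin.zero) _) (cong (ℕ→ℚ (f Fin.zero) +ℚ_) (ℕ→ℚ-homo-sum m (λ i → f (Fin.suc i))))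

floorℕ : ℚ → ℕ
floorℕ x = ∣ floor x ∣

+floorℕ≡floor : ∀ x → 0ℚ ≤ℚ x → + floorℕ x ≡ floor x
+floorℕ≡floor (mkℚ (+ m) d _) _ = ℤ.0≤i⇒+∣i∣≡i (0≤n⇒0≤n/d (+ m) (+ suc d) (+≤+ z≤n) (+≤+ z≤n))
+floorℕ≡floor (mkℚ -[1+ m ] d _) (*≤* ())

frac+floorℕ≡id : ∀ x → 0ℚ ≤ℚ x → frac x +ℚ ℕ→ℚ (floorℕ x) ≡ x
frac+floorℕ≡id x 0≤x = begin
  frac x +ℚ ℕ→ℚ (floorℕ x)        ≡⟨ cong (λ z → frac x +ℚ z / 1) (+floorℕ≡floor x 0≤x) ⟩
  frac x +ℚ floor x / 1           ≡⟨ //-rightDividesˡ (floor x / 1) x ⟩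
  x                               ∎

sumℕ-+floorℕ≡sumℚ : ∀ m (x : Fin m → ℚ) (b : Fin m → ℕ) → (∀ i → 0ℚ ≤ℚ x i) →
               ℕ→ℚ (sumℕ m b) ≡ sumℚ m (λ i → frac (x i)) →
               ℕ→ℚ (sumℕ m (λ i → b i +ℕ floorℕ (x i))) ≡ sumℚ m x
sumℕ-+floorℕ≡sumℚ m x b 0≤x Σb≡Σfrac = begin
  ℕ→ℚ (sumℕ m (λ i → b i +ℕ floorℕ (x i)))
    ≡⟨ ℕ→ℚ-homo-sum m _ ⟩
  sumℚ m (λ i → ℕ→ℚ (b i +ℕ floorℕ (x i)))
    ≡⟨ sumℚ-cong m (λ i → ℕ→ℚ-homo-+ (b i) _) ⟩
  sumℚ m (λ i → ℕ→ℚ (b i) +ℚ ℕ→ℚ (floorℕ (x i)))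
    ≡⟨ sumℚ-distrib-+ m _ _ ⟩
  sumℚ m (λ i → ℕ→ℚ (b i)) +ℚ sumℚ m (λ i → ℕ→ℚ (floorℕ (x i)))
    ≡⟨ cong (_+ℚ _) (trans (sym (ℕ→ℚ-homo-sum m b)) Σb≡Σfrac) ⟩
  sumℚ m (λ i → frac (x i)) +ℚ sumℚ m (λ i → ℕ→ℚ (floorℕ (x i)))
    ≡⟨ sym (sumℚ-distrib-+ m _ _) ⟩
  sumℚ m (λ i → frac (x i) +ℚ ℕ→ℚ (floorℕ (x i)))
    ≡⟨ sumℚ-cong m (λ i → frac+floorℕ≡id (x i) (0≤x i)) ⟩
  sumℚ m x
    ∎

isOutline-+floorℕ : ∀ {u v t p q r} (O : Fin t → Fin u → Fin v → ℚ) →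
  IsRationalOutline u v t p q r O →
  (B : Fin u → Fin v → Fin t → ℕ) →
  (∀ i j → ℕ→ℚ (sumℕ t (λ l → B i j l)) ≡ sumℚ t (λ l → frac (O l i j))) →
  (∀ i l → ℕ→ℚ (sumℕ v (λ j → B i j l)) ≡ sumℚ v (λ j → frac (O l i j))) →
  (∀ j l → ℕ→ℚ (sumℕ u (λ i → B i j l)) ≡ sumℚ u (λ i → frac (O l i j))) →
  IsOutline u v t p q r (λ i j l → B i j l +ℕ floorℕ (O l i j))
isOutline-+floorℕ {u} {v} {t} O (0≤O , cellO , rowO , colO) B cellB rowB colB =
  (λ i j → ℕ→ℚ-injective (trans (sumℕ-+floorℕ≡sumℚ t _ _ (λ l → 0≤O l i j) (cellB i j)) (cellO i j))) ,
  (λ i l → ℕ→ℚ-injective (trans (sumℕ-+floorℕ≡sumℚ v _ _ (λ j → 0≤O l i j) (rowB i l)) (rowO i l))) ,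
  (λ j l → ℕ→ℚ-injective (trans (sumℕ-+floorℕ≡sumℚ u _ _ (λ i → 0≤O l i j) (colB j l)) (colO j l)))

mainTheorem1 : (n u : ℕ) (p : Fin u → ℕ) → IsPartition n u p →
    (O : Fin u → Fin u → Fin u → ℚ) →
    IsRationalOutline u u u p p p O → IsSymmetric u O →
    (B : Fin u → Fin u → Fin u → ℕ) →
    (∀ i j → ℕ→ℚ (sumℕ u (λ l → B i j l)) ≡ sumℚ u (λ k → frac (O k i j))) →
    (∀ i j → ℕ→ℚ (sumℕ u (λ c → B i c j)) ≡ sumℚ u (λ k → frac (O k i j))) →
    (∀ i j → ℕ→ℚ (sumℕ u (λ r → B r i j)) ≡ sumℚ u (λ k → frac (O k i j))) →
    Σ (Fin u → Fin u → Fin u → ℕ) (λ A → IsOutline u u u p p p A)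
mainTheorem1 n u p _ O outline symmetric B cellB rowB colB =
  _ , isOutline-+floorℕ {p = p} {q = p} {r = p} O outline B cellB
        (λ i l → trans (rowB i l) (sumℚ-cong u (λ k → cong frac (O-swap-first-last i l k))))
        (λ j l → trans (colB j l) (sumℚ-cong u (λ k → cong frac (O-rotate j l k))))
  where
  O-swap-first-last : ∀ i j k → O k i j ≡ O j i k
  O-swap-first-last i j k with symmetric i j k
  ... | _ , eq , _ = eq

  O-rotate : ∀ i j k → O k i j ≡ O j k i
  O-rotate i j k with symmetric i j k
  ... | _ , _ , _ , _ , eq = eq
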